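{- Let $k\ge1$ and $m>1$ be integers, let $i_1,\dots,i_{m-1}\in\{1,\dots,k\}$, and let $R=R_{i_1}\cup\cdots\cup R_{i_{m-1}}$. Let $\mathcal{R}=\mathfrak{c}(R)$ be the $(k+1)$-core corresponding to $R$. Then $\mathcal{R}$ has exactly one addable residue: there is a unique $i\in\{0,1,\dots,k\}$ such that $\mathcal{R}$ has an addable cell of content $i$, equivalently $u_i\mathcal{R}\neq0$.
   Context: A $(k+1)$-core is a partition with no removable $(k+1)$-rim hook. The content (residue) of a cell $(i,j)$ of a Young diagram is $j-i\bmod(k+1)$. A partition is $k$-bounded if all its parts are $\le k$. There is a bijection $\mathfrak{p}$ from $(k+1)$-cores to $k$-bounded partitions: the $i$-th part of $\mathfrak{p}(\mu)$ is the number of cells in row $i$ of $\mu$ with hook length $<k+1$. Let $\mathfrak{c}=\mathfrak{p}^{ -1}$. For a $(k+1)$-core $\nu$, $u_i\nu$ is the core obtained by adding all addable cells of content $i$ if $\nu$ has at least one such cell, and $u_i\nu=0$ otherwise. $R_i=(i^{k+1-i})$ for $1\le i\le k$ (the rectangle with $k+1-i$ rows of length $i$). $\lambda\cup\mu$ is the partition with the parts of $\lambda$ and $\mu$ combined and sorted into non-increasing order. -}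

module Defs where

open import Data.Nat using (ℕ; zero; suc; _+_; _*_; _∸_; _≤_; _<_; _≤?_; _<?_)
open import Data.Nat.Properties using ()
open import Data.Integer as ℤ using (ℤ; +_)
open import Data.Integer.DivMod using (_%ℕ_)
open import Data.List using (List; []; _∷_; length; filter; upTo; replicate; concatMap)
open import Data.Nat.ListAction using (sum)
open import Data.Vec using (Vec; toList)
open import Data.Product using (Σ; _×_; _,_; ∃)
open import Data.Sum using (_⊎_)
open import Data.Empty using (⊥)
open import Relation.Nullary using (¬_; yes; no)
open import Relation.Binary.PropositionalEquality using (_≡_)

-- Partitions are lists of parts (rows, top to bottom); rows are 0-indexed.
-- part λ i = length of row i (0 beyond the last row).
part : List ℕ → ℕ → ℕ
part []       _       = 0
part (x ∷ xs) zero    = x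
part (x ∷ xs) (suc i) = part xs i

data Positive : List ℕ → Set where
  []  : Positive []
  _∷_ : ∀ {x xs} → 0 < x → Positive xs → Positive (x ∷ xs)

IsPartition : List ℕ → Set
IsPartition λ' = Positive λ' × (∀ i → part λ' (suc i) ≤ part λ' i)

-- cells are pairs (row, column), 0-indexed
Cell : Set
Cell = ℕ × ℕ

InDiagram : List ℕ → Cell → Set
InDiagram λ' (i , j) = j < part λ' i

InSkew : List ℕ → List ℕ → Cell → Set
InSkew λ' ν c = InDiagram λ' c × ¬ InDiagram ν c

Adjacent : Cell → Cell → Set
Adjacent (i , j) (i' , j') =
  (i ≡ i' × (j' ≡ suc j ⊎ j ≡ suc j')) ⊎ (j ≡ j' × (i' ≡ suc i ⊎ i ≡ suc i'))

data PathIn (S : Cell → Set) : Cell → Cell → Set where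
  here : ∀ {c} → S c → PathIn S c c
  step : ∀ {c d e} → S c → Adjacent c d → PathIn S d e → PathIn S c e

Connected : (Cell → Set) → Set
Connected S = ∀ c d → S c → S d → PathIn S c d

No2x2 : (Cell → Set) → Set
No2x2 S = ¬ (Σ ℕ λ i → Σ ℕ λ j →
  S (i , j) × S (suc i , j) × S (i , suc j) × S (suc i , suc j))

RemovableRimHook : ℕ → List ℕ → List ℕ → Set
RemovableRimHook r λ' ν =
  IsPartition ν × (∀ i → part ν i ≤ part λ' i) × (sum λ' ∸ sum ν ≡ r)
  × (sum ν ≤ sum λ') × Connected (InSkew λ' ν) × No2x2 (InSkew λ' ν)

IsCore : ℕ → List ℕ → Set
IsCore k μ = IsPartition μ × ¬ (Σ (List ℕ) λ ν → RemovableRimHook (suc k) μ ν)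

colLen : List ℕ → ℕ → ℕ
colLen λ' j = length (filter (λ x → j <? x) λ')

hook : List ℕ → ℕ → ℕ → ℕ
hook λ' i j = (part λ' i ∸ suc j) + (colLen λ' j ∸ suc i) + 1

-- i-th part of 𝔭(μ): number of cells of row i with hook length < k+1
pPart : ℕ → List ℕ → ℕ → ℕ
pPart k μ i = length (filter (λ j → hook μ i j <? suc k) (upTo (part μ i)))

residue : ℕ → Cell → ℕ
residue k (i , j) = ((+ j) ℤ.- (+ i)) %ℕ (suc k)

Addable : List ℕ → Cell → Set
Addable μ (i , j) = j ≡ part μ i × (i ≡ 0 ⊎ j < part μ (i ∸ 1))

HasAddableResidue : ℕ → List ℕ → ℕ → Set
HasAddableResidue k μ r = Σ Cell λ c → Addable μ c × residue k c ≡ r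

rect : ℕ → ℕ → List ℕ
rect k i = replicate (suc k ∸ i) i

insertDesc : ℕ → List ℕ → List ℕ
insertDesc x [] = x ∷ []
insertDesc x (y ∷ ys) with y ≤? x
... | yes _ = x ∷ y ∷ ys
... | no  _ = y ∷ insertDesc x ys

sortDesc : List ℕ → List ℕ
sortDesc [] = []
sortDesc (x ∷ xs) = insertDesc x (sortDesc xs)

rectUnion : ℕ → List ℕ → List ℕ
rectUnion k is = sortDesc (concatMap (rect k) is)

-- In a (k+1)-core no hook has length k+1 (its rim hook would be removable), and hooks
-- decrease along a row, so the cells of row i with hook < k+1 are the last ℓᵢ = 𝔭(μ)ᵢ ≤ k
-- cells of the row; this forces μ_{i+k+1−ℓᵢ} = μᵢ − ℓᵢ. If 𝔭(μ) = R is a union of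
-- rectangles, a maximal run of parts equal to v has length divisible by k+1−v. Let Z be the
-- number of parts of R. From a row that starts a run, or that ends in an addable cell, one
-- steps down by the whole run, resp. by k+1−v rows, to another such row, and μᵢ + (Z − i)
-- changes by a multiple of k+1; at row Z it vanishes. Hence every addable cell (i , μᵢ) has
-- content ≡ −Z, the content of the addable cell (Z , 0).

module Submission where

open import Defs
open import Data.Nat
open import Data.Nat.Properties
open import Data.Nat.Divisibility using (_∣_; divides; _∣0; n∣m*n; ∣m∣n⇒∣m+n)
open import Data.Nat.DivMod using (_%_; [m+n]%n≡m%n; m<n⇒m%n≡m; n%n≡0; m%n<n)
open import Data.Nat.Induction using (<-rec)
open import Data.Nat.ListAction using (sum)
open import Data.Nat.Tactic.RingSolver using (solve-∀)
import Data.Integer as ℤ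
import Data.Integer.Properties as ℤP
open import Data.Integer.DivMod using (_%ℕ_; n%ℕd<d)
import Data.Integer.Tactic.RingSolver as ℤ-Solver
open import Data.List using (List; []; _∷_; length; filter; upTo; replicate; concatMap; _++_; [_])
open import Data.List.Properties
  using (length-++; filter-++; upTo-∷ʳ; length-filter; length-upTo; filter-accept; filter-reject; filter-all; filter-none; length-replicate)
open import Data.List.Relation.Unary.All as All using (All; []; _∷_)
open import Data.List.Relation.Unary.All.Properties using (replicate⁺; concat⁺; map⁺; applyUpTo⁺₁)
open import Data.List.Relation.Unary.Linked as Linked using (Linked; []; [-]; _∷_)
open import Data.List.Relation.Unary.Linked.Properties using (Linked⇒All)
open import Data.List.Relation.Binary.Permutation.Propositional using (_↭_; ↭-sym)
open import Data.List.Relation.Binary.Permutation.Propositional.Properties using (↭-length; filter-↭; All-resp-↭)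
open import Relation.Binary.Properties.DecTotalOrder ≤-decTotalOrder using (≥-decTotalOrder)
open import Data.List.Sort.InsertionSort ≥-decTotalOrder as Sort using ()
open import Data.List.Sort.InsertionSort.Properties ≥-decTotalOrder using (sort-↭; sort-↗)
open import Data.Vec using (Vec; lookup; toList)
open import Data.Vec.Relation.Unary.All.Properties using (toList⁺; lookup⁻)
open import Data.Product using (Σ; _×_; _,_; proj₁; proj₂)
open import Data.Sum using (_⊎_; inj₁; inj₂)
open import Data.Unit using (⊤; tt)
open import Function using (_∘_; _⇔_; mk⇔; Equivalence)
open import Level using (0ℓ)
open import Relation.Nullary using (¬_; yes; no; contradiction)
open import Relation.Nullary.Decidable using (dec-true; dec-false)
open import Relation.Unary using (Pred; Decidable)
open import Relation.Binary.PropositionalEquality hiding ([_])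

NonIncreasing : (ℕ → ℕ) → Set
NonIncreasing g = ∀ i → g (suc i) ≤ g i

antitone : ∀ g → NonIncreasing g → ∀ {i i'} → i ≤ i' → g i' ≤ g i
antitone g g↓ = go ∘ ≤⇒≤′
  where
    go : ∀ {i i'} → i ≤′ i' → g i' ≤ g i
    go ≤′-refl = ≤-refl
    go (≤′-step p) = ≤-trans (g↓ _) (go p)

part-≥length : ∀ l {i} → length l ≤ i → part l i ≡ 0
part-≥length [] _ = refl
part-≥length (x ∷ l) {suc i} (s≤s le) = part-≥length l le

colLen-∷-< : ∀ {j x} xs → j < x → colLen (x ∷ xs) j ≡ suc (colLen xs j)
colLen-∷-< {j} xs j<x = cong length (filter-accept (j <?_) j<x)

colLen-∷-≮ : ∀ {j x} xs → ¬ j < x → colLen (x ∷ xs) j ≡ colLen xs j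
colLen-∷-≮ {j} xs j≮x = cong length (filter-reject (j <?_) j≮x)

<colLen⇒<part : ∀ l → NonIncreasing (part l) → ∀ {r j} → r < colLen l j → j < part l r
<colLen⇒<part (x ∷ xs) l↓ {r} {j} r<c with j <? x
<colLen⇒<part (x ∷ xs) l↓ {zero}  r<c | yes j<x = j<x
<colLen⇒<part (x ∷ xs) l↓ {suc r} r<c | yes j<x rewrite colLen-∷-< xs j<x =
  <colLen⇒<part xs (l↓ ∘ suc) (s≤s⁻¹ r<c)
... | no j≮x rewrite colLen-∷-≮ xs j≮x =
  contradiction (<-≤-trans (<colLen⇒<part xs (l↓ ∘ suc) r<c) (antitone (part (x ∷ xs)) l↓ {i' = suc r} z≤n)) j≮x

<part⇒<colLen : ∀ l → NonIncreasing (part l) → ∀ {r j} → j < part l r → r < colLen l j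
<part⇒<colLen (x ∷ xs) l↓ {r} {j} j<p with j <? x
<part⇒<colLen (x ∷ xs) l↓ {zero}  j<p | yes j<x rewrite colLen-∷-< xs j<x = s≤s z≤n
<part⇒<colLen (x ∷ xs) l↓ {suc r} j<p | yes j<x rewrite colLen-∷-< xs j<x =
  s≤s (<part⇒<colLen xs (l↓ ∘ suc) j<p)
... | no j≮x = contradiction (<-≤-trans j<p (antitone (part (x ∷ xs)) l↓ {i' = r} z≤n)) j≮x

colLen-antitone : ∀ l → NonIncreasing (part l) → NonIncreasing (colLen l)
colLen-antitone l l↓ j = ≮⇒≥ λ c<c' →
  <-irrefl refl (<part⇒<colLen l l↓ (<-trans (n<1+n j) (<colLen⇒<part l l↓ c<c')))

module UpwardClosed {P : Pred ℕ 0ℓ} (P? : Decidable P) (P↑ : ∀ {j} → P j → P (suc j)) where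

  #below : ℕ → ℕ
  #below n = length (filter P? (upTo n))

  #below≤ : ∀ n → #below n ≤ n
  #below≤ n = ≤-trans (length-filter P? (upTo n)) (≤-reflexive (length-upTo n))

  P-mono : ∀ {j j'} → j ≤ j' → P j → P j'
  P-mono = go ∘ ≤⇒≤′
    where
      go : ∀ {j j'} → j ≤′ j' → P j → P j'
      go ≤′-refl     = λ p → p
      go (≤′-step q) = P↑ ∘ go q

  #below-suc : ∀ n → #below (suc n) ≡ #below n + length (filter P? [ n ])
  #below-suc n = begin
    length (filter P? (upTo (suc n)))             ≡⟨ cong (length ∘ filter P?) (upTo-∷ʳ n) ⟨
    length (filter P? (upTo n ++ [ n ]))          ≡⟨ cong length (filter-++ P? (upTo n) [ n ]) ⟩
    length (filter P? (upTo n) ++ filter P? [ n ]) ≡⟨ length-++ (filter P? (upTo n)) ⟩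
    #below n + length (filter P? [ n ])           ∎
    where open ≡-Reasoning

  #below-none : ∀ {n} → ¬ P n → #below n ≡ 0
  #below-none {n} ¬Pn = cong length (filter-none P? (applyUpTo⁺₁ _ n λ j<n Pj → ¬Pn (P-mono (<⇒≤ j<n) Pj)))

  P⇔threshold≤ : ∀ {n j} → j < n → P j ⇔ n ∸ #below n ≤ j
  P⇔threshold≤ {suc n} {j} j<1+n with P? n | #below-suc n
  ... | yes Pn | #≡ rewrite #≡ | +-comm (#below n) 1 with m≤n⇒m<n∨m≡n (s≤s⁻¹ j<1+n)
  ...   | inj₁ j<n  = P⇔threshold≤ j<n
  ...   | inj₂ refl = mk⇔ (λ _ → m∸n≤m n (#below n)) (λ _ → Pn)
  P⇔threshold≤ {suc n} {j} j<1+n | no ¬Pn | #≡ rewrite #≡ | #below-none ¬Pn =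
    mk⇔ (λ Pj → contradiction (P-mono (s≤s⁻¹ j<1+n) Pj) ¬Pn) (λ 1+n≤j → contradiction j<1+n (≤⇒≯ 1+n≤j))

leg : List ℕ → ℕ → ℕ → ℕ
leg μ i j = colLen μ j ∸ suc i

hook-arm : ∀ μ {i j x} → part μ i ≡ j + suc x → hook μ i j ≡ suc (x + leg μ i j)
hook-arm μ {i} {j} {x} eq = begin
  (part μ i ∸ suc j) + leg μ i j + 1 ≡⟨ cong (λ p → (p ∸ suc j) + leg μ i j + 1) eq ⟩
  (j + suc x ∸ suc j) + leg μ i j + 1 ≡⟨ cong (λ p → (p ∸ suc j) + leg μ i j + 1) (+-suc j x) ⟩
  (j + x ∸ j) + leg μ i j + 1         ≡⟨ cong (λ a → a + leg μ i j + 1) (m+n∸m≡n j x) ⟩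
  x + leg μ i j + 1                   ≡⟨ +-comm (x + leg μ i j) 1 ⟩
  suc (x + leg μ i j)                 ∎
  where open ≡-Reasoning

module _ (μ : List ℕ) (μ↓ : NonIncreasing (part μ)) where

  hook-antitone : ∀ i j → hook μ i (suc j) ≤ hook μ i j
  hook-antitone i j = +-monoˡ-≤ 1 (+-mono-≤ (∸-monoʳ-≤ (part μ i) (n≤1+n (suc j)))
                                             (∸-monoˡ-≤ (suc i) (colLen-antitone μ μ↓ j)))

  ≤leg⇒<part : ∀ {i j d} → j < part μ i → d ≤ leg μ i j → j < part μ (i + d)
  ≤leg⇒<part {i} {j} {d} j<μi d≤leg = <colLen⇒<part μ μ↓ (begin-strict
    i + d     <⟨ s≤s (≤-reflexive (+-comm i d)) ⟩
    suc d + i ≡⟨ +-suc d i ⟨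
    d + suc i ≤⟨ m≤o∸n⇒m+n≤o d (<part⇒<colLen μ μ↓ j<μi) d≤leg ⟩
    colLen μ j ∎)
    where open ≤-Reasoning

  <part⇒≤leg : ∀ {i j d} → j < part μ (i + d) → d ≤ leg μ i j
  <part⇒≤leg {i} {j} {d} j<μ[i+d] = m+n≤o⇒m≤o∸n d (begin
    d + suc i  ≡⟨ +-suc d i ⟩
    suc d + i  ≡⟨ cong suc (+-comm d i) ⟩
    suc i + d  ≤⟨ <part⇒<colLen μ μ↓ j<μ[i+d] ⟩
    colLen μ j ∎)
    where open ≤-Reasoning

module CoreRows (k : ℕ) (μ : List ℕ) (μ↓ : NonIncreasing (part μ))
                (no-K-hook : ∀ {i j} → j < part μ i → hook μ i j ≢ suc k) where

  K : ℕ
  K = suc k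

  -- The cells of row i with hook < K are its last ℓ cells, the first of them in column a.
  module Row (i : ℕ) where

    open UpwardClosed (λ j → hook μ i j <? K) (λ {j} → ≤-<-trans (hook-antitone μ μ↓ i j))

    ℓ a : ℕ
    ℓ = pPart k μ i
    a = part μ i ∸ ℓ

    pPart≤part : ℓ ≤ part μ i
    pPart≤part = #below≤ (part μ i)

    first-short-hook : a < part μ i → hook μ i a ≡ ℓ + leg μ i a
    first-short-hook a<μi with ℓ in ℓ≡
    ... | zero    = contradiction a<μi (<-irrefl refl)
    ... | suc ℓ' = hook-arm μ (sym (trans (cong (λ l → (part μ i ∸ l) + l) (sym ℓ≡)) (m∸n+n≡m pPart≤part)))

    first-short<K : a < part μ i → hook μ i a < K
    first-short<K a<μi = Equivalence.from (P⇔threshold≤ a<μi) ≤-refl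

    last-long-hook : ∀ {a'} → a ≡ suc a' → hook μ i a' ≡ suc (ℓ + leg μ i a')
    last-long-hook {a'} a≡ = hook-arm μ (begin
      part μ i     ≡⟨ m∸n+n≡m pPart≤part ⟨
      a + ℓ        ≡⟨ cong (_+ ℓ) a≡ ⟩
      suc a' + ℓ   ≡⟨ +-suc a' ℓ ⟨
      a' + suc ℓ   ∎)
      where open ≡-Reasoning

    K<last-long : ∀ {a'} → a ≡ suc a' → K < hook μ i a'
    K<last-long {a'} a≡ = ≤∧≢⇒< (≮⇒≥ long) (λ K≡hook → no-K-hook a'<μi (sym K≡hook))
      where
        a'<μi : a' < part μ i
        a'<μi = <-≤-trans (≤-reflexive (sym a≡)) (m∸n≤m (part μ i) ℓ)
        long : ¬ hook μ i a' < K
        long short = <-irrefl refl (≤-trans (≤-reflexive (sym a≡)) (Equivalence.to (P⇔threshold≤ a'<μi) short))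

    a<part : 0 < ℓ → a < part μ i
    a<part 0<ℓ = ∸-monoʳ-< 0<ℓ pPart≤part

    pPart≤k : ℓ ≤ k
    pPart≤k with 0 <? ℓ
    ... | no ℓ≯0 = ≤-trans (≮⇒≥ ℓ≯0) z≤n
    ... | yes 0<ℓ = s≤s⁻¹ (begin-strict
      ℓ              ≤⟨ m≤m+n ℓ (leg μ i a) ⟩
      ℓ + leg μ i a  ≡⟨ first-short-hook (a<part 0<ℓ) ⟨
      hook μ i a     <⟨ first-short<K (a<part 0<ℓ) ⟩
      K              ∎)
      where open ≤-Reasoning

    part-shift : part μ (i + (K ∸ ℓ)) + ℓ ≡ part μ i
    part-shift = trans (cong (_+ ℓ) (≤-antisym below above)) (m∸n+n≡m pPart≤part)
      where
        d = K ∸ ℓ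

        below : part μ (i + d) ≤ a
        below = ≮⇒≥ λ a<μ[i+d] →
          let a<μi = <-≤-trans a<μ[i+d] (antitone (part μ) μ↓ (m≤m+n i d)) in
          <⇒≱ (first-short<K a<μi) (begin
            K                ≤⟨ m≤n+m∸n K ℓ ⟩
            ℓ + d            ≤⟨ +-monoʳ-≤ ℓ (<part⇒≤leg μ μ↓ a<μ[i+d]) ⟩
            ℓ + leg μ i a    ≡⟨ first-short-hook a<μi ⟨
            hook μ i a       ∎)
          where open ≤-Reasoning

        above : a ≤ part μ (i + d)
        above with a in a≡
        ... | zero   = z≤n
        ... | suc a' = ≤leg⇒<part μ μ↓ a'<μi (m≤n+o⇒m∸n≤o K ℓ (s≤s⁻¹ K<hook))
          where
            a'<μi : a' < part μ i
            a'<μi = <-≤-trans (≤-reflexive (sym a≡)) (m∸n≤m (part μ i) ℓ)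
            K<hook : K < suc (ℓ + leg μ i a')
            K<hook = subst (K <_) (last-long-hook a≡) (K<last-long a≡)

  open Row public using (pPart≤part; pPart≤k; part-shift)

sumBelow : (ℕ → ℕ) → ℕ → ℕ
sumBelow g zero    = 0
sumBelow g (suc n) = sumBelow g n + g n

sumBelow-+ : ∀ g h n → sumBelow (λ r → g r + h r) n ≡ sumBelow g n + sumBelow h n
sumBelow-+ g h zero    = refl
sumBelow-+ g h (suc n) = trans (cong (_+ (g n + h n)) (sumBelow-+ g h n)) (interchange (sumBelow g n) (sumBelow h n) (g n) (h n))
  where
    interchange : ∀ a b c d → (a + b) + (c + d) ≡ (a + c) + (b + d)
    interchange = solve-∀

sumBelow-cong : ∀ {g h} n → (∀ r → g r ≡ h r) → sumBelow g n ≡ sumBelow h n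
sumBelow-cong zero    g≗h = refl
sumBelow-cong (suc n) g≗h = cong₂ _+_ (sumBelow-cong n g≗h) (g≗h n)

sumBelow-suc : ∀ g n → sumBelow g (suc n) ≡ g 0 + sumBelow (g ∘ suc) n
sumBelow-suc g zero    = +-comm 0 (g 0)
sumBelow-suc g (suc n) = trans (cong (_+ g (suc n)) (sumBelow-suc g n)) (+-assoc (g 0) _ _)

sumBelow-vanishing : ∀ {g} n → (∀ r → r < n → g r ≡ 0) → sumBelow g n ≡ 0
sumBelow-vanishing zero    g≡0 = refl
sumBelow-vanishing (suc n) g≡0 =
  cong₂ _+_ (sumBelow-vanishing n (λ r → g≡0 r ∘ m<n⇒m<1+n)) (g≡0 n ≤-refl)

sumBelow-stable : ∀ {g n n'} → (∀ r → n ≤ r → g r ≡ 0) → n ≤ n' → sumBelow g n' ≡ sumBelow g n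
sumBelow-stable {g} {n} g≡0 = go ∘ ≤⇒≤′
  where
    go : ∀ {n'} → n ≤′ n' → sumBelow g n' ≡ sumBelow g n
    go ≤′-refl = refl
    go (≤′-step p) = trans (cong₂ _+_ (go p) (g≡0 _ (≤′⇒≤ p))) (+-identityʳ _)

sum≡sumBelow-part : ∀ l n → length l ≤ n → sum l ≡ sumBelow (part l) n
sum≡sumBelow-part []       n       _         = sym (sumBelow-vanishing n (λ _ _ → refl))
sum≡sumBelow-part (x ∷ xs) (suc n) (s≤s len≤n) =
  trans (cong (x +_) (sum≡sumBelow-part xs n len≤n)) (sym (sumBelow-suc (part (x ∷ xs)) n))

toPartition : (ℕ → ℕ) → ℕ → List ℕ
toPartition g zero    = []
toPartition g (suc n) with g 0
... | zero  = []
... | suc x = suc x ∷ toPartition (g ∘ suc) n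

vanishes-after : ∀ g → NonIncreasing g → ∀ {r r'} → g r ≡ 0 → r ≤ r' → g r' ≡ 0
vanishes-after g g↓ g≡0 r≤r' = n≤0⇒n≡0 (≤-trans (antitone g g↓ r≤r') (≤-reflexive g≡0))

part-toPartition : ∀ g n → NonIncreasing g → g n ≡ 0 → ∀ r → part (toPartition g n) r ≡ g r
part-toPartition g zero    g↓ g0≡0 r = sym (vanishes-after g g↓ g0≡0 z≤n)
part-toPartition g (suc n) g↓ gn≡0 r with g 0 in g0≡
... | zero = sym (vanishes-after g g↓ g0≡ z≤n)
part-toPartition g (suc n) g↓ gn≡0 zero    | suc x = sym g0≡
part-toPartition g (suc n) g↓ gn≡0 (suc r) | suc x = part-toPartition (g ∘ suc) n (g↓ ∘ suc) gn≡0 r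

toPartition-positive : ∀ g n → Positive (toPartition g n)
toPartition-positive g zero    = []
toPartition-positive g (suc n) with g 0
... | zero  = []
... | suc x = s≤s z≤n ∷ toPartition-positive (g ∘ suc) n

length-toPartition : ∀ g n → length (toPartition g n) ≤ n
length-toPartition g zero    = z≤n
length-toPartition g (suc n) with g 0
... | zero  = z≤n
... | suc x = s≤s (length-toPartition (g ∘ suc) n)

Adjacent-sym : ∀ {c d} → Adjacent c d → Adjacent d c
Adjacent-sym (inj₁ (refl , inj₁ eq)) = inj₁ (refl , inj₂ eq)
Adjacent-sym (inj₁ (refl , inj₂ eq)) = inj₁ (refl , inj₁ eq)
Adjacent-sym (inj₂ (refl , inj₁ eq)) = inj₂ (refl , inj₂ eq)
Adjacent-sym (inj₂ (refl , inj₂ eq)) = inj₂ (refl , inj₁ eq)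

module _ {S : Cell → Set} where

  path-start : ∀ {c d} → PathIn S c d → S c
  path-start (here s)     = s
  path-start (step s _ _) = s

  path-++ : ∀ {c d e} → PathIn S c d → PathIn S d e → PathIn S c e
  path-++ (here _)       q = q
  path-++ (step s adj p) q = step s adj (path-++ p q)

  path-reverse : ∀ {c d} → PathIn S c d → PathIn S d c
  path-reverse (here s)       = here s
  path-reverse (step s adj p) = path-++ (path-reverse p) (step (path-start p) (Adjacent-sym adj) (here s))

  connected-to : ∀ e → (∀ c → S c → PathIn S c e) → Connected S
  connected-to e to-e c d Sc Sd = path-++ (to-e c Sc) (path-reverse (to-e d Sd))

  horizontal-path : ∀ {r y x} → y ≤ x → (∀ {t} → y ≤ t → t ≤ x → S (r , t)) → PathIn S (r , x) (r , y)
  horizontal-path {r} {y} y≤x inS = go (≤⇒≤′ y≤x) inS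
    where
      go : ∀ {x'} → y ≤′ x' → (∀ {t} → y ≤ t → t ≤ x' → S (r , t)) → PathIn S (r , x') (r , y)
      go ≤′-refl      inS' = here (inS' ≤-refl ≤-refl)
      go (≤′-step y≤x') inS' = step (inS' (≤′⇒≤ (≤′-step y≤x')) ≤-refl) (inj₁ (refl , inj₂ refl))
                                    (go y≤x' (λ y≤t t≤x' → inS' y≤t (m≤n⇒m≤1+n t≤x')))

≤∧<⇒pred< : ∀ {x y z} → x ≤ y → z < y → pred x < y
≤∧<⇒pred< {zero}  x≤y z<y = ≤-<-trans z≤n z<y
≤∧<⇒pred< {suc x} x≤y z<y = x≤y

hook+j≡part+leg : ∀ μ {i j} → j < part μ i → hook μ i j + j ≡ part μ i + leg μ i j
hook+j≡part+leg μ {i} {j} j<μi = begin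
  hook μ i j + j                ≡⟨ cong (_+ j) (hook-arm μ (sym (trans (+-suc j x) (m+[n∸m]≡n j<μi)))) ⟩
  suc (x + leg μ i j) + j       ≡⟨ +-comm (suc (x + leg μ i j)) j ⟩
  j + suc (x + leg μ i j)       ≡⟨ +-suc j (x + leg μ i j) ⟩
  suc (j + (x + leg μ i j))     ≡⟨ cong suc (+-assoc j x (leg μ i j)) ⟨
  suc (j + x) + leg μ i j       ≡⟨ cong (_+ leg μ i j) (m+[n∸m]≡n j<μi) ⟩
  part μ i + leg μ i j          ∎
  where
    open ≡-Reasoning
    x = part μ i ∸ suc j

-- ν is μ without the rim hook of the cell (i , j): b is the bottom row of column j, and each
-- row r of i … b is cut back to μ_{r+1} − 1, but not to the left of column j.
module RimHook (μ : List ℕ) (μ↓ : NonIncreasing (part μ)) {i j : ℕ} (j<μi : j < part μ i) where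

  m : ℕ → ℕ
  m = part μ

  i<colLen : i < colLen μ j
  i<colLen = <part⇒<colLen μ μ↓ j<μi

  b : ℕ
  b = pred (colLen μ j)

  colLen≡ : colLen μ j ≡ suc b
  colLen≡ = sym (suc-pred (colLen μ j))
    where instance _ = >-nonZero (≤-<-trans z≤n i<colLen)

  i≤b : i ≤ b
  i≤b = s≤s⁻¹ (subst (i <_) colLen≡ i<colLen)

  j<part : ∀ {r} → r ≤ b → j < m r
  j<part r≤b = <colLen⇒<part μ μ↓ (subst (_ <_) (sym colLen≡) (s≤s r≤b))

  part-below-b : m (suc b) ≤ j
  part-below-b = ≮⇒≥ λ j<μ[1+b] → <-irrefl (sym colLen≡) (<part⇒<colLen μ μ↓ j<μ[1+b])

  b<length : b < length μ
  b<length = ≤-trans (≤-reflexive (sym colLen≡)) (length-filter (j <?_) μ)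

  data Band (r : ℕ) : Set where
    above  : r < i → Band r
    inside : i ≤ r → r ≤ b → Band r
    below  : b < r → Band r

  band : ∀ r → Band r
  band r with i ≤? r | r ≤? b
  ... | yes i≤r | yes r≤b = inside i≤r r≤b
  ... | yes _   | no  r≰b = below (≰⇒> r≰b)
  ... | no  i≰r | _       = above (≰⇒> i≰r)

  ν-row : ℕ → ℕ
  ν-row r with band r
  ... | above _    = m r
  ... | inside _ _ = pred (m (suc r)) ⊔ j
  ... | below _    = m r

  ν-outside : ∀ {r} → r < i ⊎ b < r → ν-row r ≡ m r
  ν-outside {r} out with band r | out
  ... | above _       | _          = refl
  ... | below _       | _          = refl
  ... | inside i≤r _  | inj₁ r<i   = contradiction i≤r (<⇒≱ r<i)
  ... | inside _ r≤b  | inj₂ b<r   = contradiction r≤b (<⇒≱ b<r)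

  ν-inside : ∀ {r} → i ≤ r → r ≤ b → ν-row r ≡ pred (m (suc r)) ⊔ j
  ν-inside {r} i≤r r≤b with band r
  ... | above r<i  = contradiction i≤r (<⇒≱ r<i)
  ... | inside _ _ = refl
  ... | below b<r  = contradiction r≤b (<⇒≱ b<r)

  ν-inside< : ∀ {r} → i ≤ r → r < b → ν-row r ≡ pred (m (suc r))
  ν-inside< i≤r r<b = trans (ν-inside i≤r (<⇒≤ r<b)) (m≥n⇒m⊔n≡m (<⇒≤pred (j<part r<b)))

  ν-b : ν-row b ≡ j
  ν-b = trans (ν-inside i≤b ≤-refl) (m≤n⇒m⊔n≡n (≤-trans pred[n]≤n part-below-b))

  ν<part : ∀ {r} → i ≤ r → r ≤ b → ν-row r < m r
  ν<part {r} i≤r r≤b = subst (_< m r) (sym (ν-inside i≤r r≤b))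
                             (⊔-lub (≤∧<⇒pred< (μ↓ r) (j<part r≤b)) (j<part r≤b))

  ν≤part : ∀ r → ν-row r ≤ m r
  ν≤part r with band r
  ... | above _        = ≤-refl
  ... | inside i≤r r≤b = <⇒≤ (subst (_< m r) (ν-inside i≤r r≤b) (ν<part i≤r r≤b))
  ... | below _        = ≤-refl

  ν-antitone : NonIncreasing ν-row
  ν-antitone r with band r
  ... | above _  = ≤-trans (ν≤part (suc r)) (μ↓ r)
  ... | below _  = ≤-trans (ν≤part (suc r)) (μ↓ r)
  ... | inside i≤r r≤b with m≤n⇒m<n∨m≡n r≤b
  ...   | inj₁ r<b = ≤-trans (≤-reflexive (ν-inside (m≤n⇒m≤1+n i≤r) r<b))
                             (⊔-monoˡ-≤ j (pred-mono-≤ (μ↓ (suc r))))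
  ...   | inj₂ refl = ≤-trans (≤-reflexive (ν-outside (inj₂ ≤-refl)))
                              (≤-trans part-below-b (m≤n⊔m (pred (m (suc b))) j))

  ν : List ℕ
  ν = toPartition ν-row (length μ)

  part-ν : ∀ r → part ν r ≡ ν-row r
  part-ν = part-toPartition ν-row (length μ) ν-antitone
             (trans (ν-outside (inj₂ b<length)) (part-≥length μ ≤-refl))

  ν-isPartition : IsPartition ν
  ν-isPartition = toPartition-positive ν-row (length μ) , λ r →
    subst₂ _≤_ (sym (part-ν (suc r))) (sym (part-ν r)) (ν-antitone r)

  removed : ℕ → ℕ
  removed r = m r ∸ ν-row r

  removed-outside : ∀ {r} → r < i ⊎ b < r → removed r ≡ 0
  removed-outside {r} out = trans (cong (m r ∸_) (ν-outside out)) (n∸n≡0 (m r))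

  removed-step : ∀ {r} → i ≤ r → r < b → removed r + m (suc r) ≡ suc (m r)
  removed-step {r} i≤r r<b = begin
    (m r ∸ ν-row r) + m (suc r)       ≡⟨ cong (λ x → (m r ∸ x) + m (suc r)) (ν-inside< i≤r r<b) ⟩
    (m r ∸ p) + m (suc r)             ≡⟨ cong ((m r ∸ p) +_) (suc-pred (m (suc r))) ⟨
    (m r ∸ p) + suc p                 ≡⟨ +-suc (m r ∸ p) p ⟩
    suc ((m r ∸ p) + p)               ≡⟨ cong suc (m∸n+n≡m (≤-trans pred[n]≤n (μ↓ r))) ⟩
    suc (m r)                         ∎
    where
      open ≡-Reasoning
      p = pred (m (suc r))
      instance _ = >-nonZero (≤-<-trans z≤n (j<part r<b))

  removed-b : removed b + j ≡ m b
  removed-b = trans (cong (λ x → (m b ∸ x) + j) ν-b) (m∸n+n≡m (<⇒≤ (j<part ≤-refl)))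

  telescope : ∀ t → i + t ≤ b → sumBelow removed (i + t) + m (i + t) ≡ m i + t
  telescope zero _ rewrite +-identityʳ i | +-identityʳ (m i) =
    cong (_+ m i) (sumBelow-vanishing i (λ _ r<i → removed-outside (inj₁ r<i)))
  telescope (suc t) i+t<b rewrite +-suc i t = begin
    sumBelow removed (i + t) + removed (i + t) + m (suc (i + t))    ≡⟨ +-assoc (sumBelow removed (i + t)) _ _ ⟩
    sumBelow removed (i + t) + (removed (i + t) + m (suc (i + t))) ≡⟨ cong (sumBelow removed (i + t) +_) (removed-step (m≤m+n i t) i+t<b) ⟩
    sumBelow removed (i + t) + suc (m (i + t))                     ≡⟨ +-suc (sumBelow removed (i + t)) (m (i + t)) ⟩
    suc (sumBelow removed (i + t) + m (i + t))                     ≡⟨ cong suc (telescope t (<⇒≤ i+t<b)) ⟩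
    suc (m i + t)                                                  ≡⟨ +-suc (m i) t ⟨
    m i + suc t                                                    ∎
    where open ≡-Reasoning

  sumBelow-removed : sumBelow removed (length μ) ≡ hook μ i j
  sumBelow-removed = begin
    sumBelow removed (length μ)   ≡⟨ sumBelow-stable (λ _ b<r → removed-outside (inj₂ b<r)) b<length ⟩
    sumBelow removed (suc b)      ≡⟨ +-cancelʳ-≡ j _ _ through-b ⟩
    hook μ i j                    ∎
    where
      open ≡-Reasoning
      i+[b∸i]≡b : i + (b ∸ i) ≡ b
      i+[b∸i]≡b = m+[n∸m]≡n i≤b
      through-b : sumBelow removed (suc b) + j ≡ hook μ i j + j
      through-b = begin
        sumBelow removed b + removed b + j   ≡⟨ +-assoc (sumBelow removed b) _ _ ⟩
        sumBelow removed b + (removed b + j) ≡⟨ cong (sumBelow removed b +_) removed-b ⟩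
        sumBelow removed b + m b             ≡⟨ subst (λ x → sumBelow removed x + m x ≡ m i + (b ∸ i)) i+[b∸i]≡b
                                                      (telescope (b ∸ i) (≤-reflexive i+[b∸i]≡b)) ⟩
        m i + (b ∸ i)                        ≡⟨ cong (λ c → m i + (c ∸ suc i)) colLen≡ ⟨
        m i + leg μ i j                      ≡⟨ hook+j≡part+leg μ j<μi ⟨
        hook μ i j + j                       ∎

  sum-μ : sum μ ≡ sum ν + hook μ i j
  sum-μ = begin
    sum μ                                             ≡⟨ sum≡sumBelow-part μ (length μ) ≤-refl ⟩
    sumBelow m (length μ)                             ≡⟨ sumBelow-cong (length μ) (λ r → sym (m+[n∸m]≡n (ν≤part r))) ⟩
    sumBelow (λ r → ν-row r + removed r) (length μ)   ≡⟨ sumBelow-+ ν-row removed (length μ) ⟩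
    sumBelow ν-row (length μ) + sumBelow removed (length μ)
      ≡⟨ cong₂ _+_ (sym (sumBelow-cong (length μ) part-ν)) sumBelow-removed ⟩
    sumBelow (part ν) (length μ) + hook μ i j         ≡⟨ cong (_+ hook μ i j) (sum≡sumBelow-part ν (length μ) (length-toPartition ν-row (length μ))) ⟨
    sum ν + hook μ i j                                ∎
    where open ≡-Reasoning

  Skew : Cell → Set
  Skew = InSkew μ ν

  skew⇒inside : ∀ {r t} → Skew (r , t) → (i ≤ r × r ≤ b) × (ν-row r ≤ t × t < m r)
  skew⇒inside {r} {t} (t<μr , t≮νr) with band r
  ... | above r<i      = contradiction (subst (t <_) (sym (trans (part-ν r) (ν-outside (inj₁ r<i)))) t<μr) t≮νr
  ... | below b<r      = contradiction (subst (t <_) (sym (trans (part-ν r) (ν-outside (inj₂ b<r)))) t<μr) t≮νr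
  ... | inside i≤r r≤b = (i≤r , r≤b) , subst (_≤ t) (ν-inside i≤r r≤b) (≮⇒≥ (t≮νr ∘ subst (t <_) (sym (part-ν r)))) , t<μr

  inside⇒skew : ∀ {r t} → ν-row r ≤ t → t < m r → Skew (r , t)
  inside⇒skew {r} {t} νr≤t t<μr = t<μr , λ t<νr → <⇒≱ (subst (t <_) (part-ν r) t<νr) νr≤t

  path-to-corner : ∀ n {r x} → r + n ≡ b → i ≤ r → ν-row r ≤ x → x < m r → PathIn Skew (r , x) (b , j)
  path-to-corner n {r} {x} r+n≡b i≤r νr≤x x<μr = path-++ along-row (down n r+n≡b)
    where
      along-row : PathIn Skew (r , x) (r , ν-row r)
      along-row = horizontal-path νr≤x (λ νr≤t t≤x → inside⇒skew νr≤t (≤-<-trans t≤x x<μr))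
      r≤b : r ≤ b
      r≤b = ≤-trans (m≤m+n r n) (≤-reflexive r+n≡b)
      down : ∀ n → r + n ≡ b → PathIn Skew (r , ν-row r) (b , j)
      down zero r+0≡b rewrite +-identityʳ r | r+0≡b = subst (λ y → PathIn Skew (b , y) (b , j)) (sym ν-b)
                                                          (here (inside⇒skew (≤-reflexive ν-b) (j<part ≤-refl)))
      down (suc n) r+1+n≡b =
        step (inside⇒skew ≤-refl (ν<part i≤r r≤b)) (inj₂ (refl , inj₁ refl))
             (path-to-corner n (trans (sym (+-suc r n)) r+1+n≡b) (m≤n⇒m≤1+n i≤r) (ν-antitone r) νr<μ[1+r])
        where
          r<b : r < b
          r<b = ≤-trans (s≤s (m≤m+n r n)) (≤-reflexive (trans (sym (+-suc r n)) r+1+n≡b))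
          νr<μ[1+r] : ν-row r < m (suc r)
          νr<μ[1+r] = subst (_< m (suc r)) (sym (ν-inside< i≤r r<b)) (≤∧<⇒pred< ≤-refl (j<part r<b))

  skew-connected : Connected Skew
  skew-connected = connected-to (b , j) λ where
    (r , t) sk → let ((i≤r , r≤b) , (νr≤t , t<μr)) = skew⇒inside sk in
                 path-to-corner (b ∸ r) (m+[n∸m]≡n r≤b) i≤r νr≤t t<μr

  skew-no2x2 : No2x2 Skew
  skew-no2x2 (r , t , sk₀₀ , sk₁₀ , _ , sk₁₁) with skew⇒inside sk₀₀ | skew⇒inside sk₁₀ | skew⇒inside sk₁₁
  ... | (i≤r , _) , (νr≤t , _) | (_ , r<b) , _ | _ , (_ , 1+t<μ[1+r]) =
    <⇒≱ 1+t<μ[1+r] (≤-trans (m≤suc[pred] (m (suc r))) (s≤s (subst (_≤ t) (ν-inside< i≤r r<b) νr≤t)))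
    where
      m≤suc[pred] : ∀ n → n ≤ suc (pred n)
      m≤suc[pred] zero    = z≤n
      m≤suc[pred] (suc n) = ≤-refl

  removableRimHook : RemovableRimHook (hook μ i j) μ ν
  removableRimHook = ν-isPartition
                   , (λ r → subst (_≤ m r) (sym (part-ν r)) (ν≤part r))
                   , trans (cong (_∸ sum ν) sum-μ) (m+n∸m≡n (sum ν) (hook μ i j))
                   , subst (sum ν ≤_) (sym sum-μ) (m≤m+n (sum ν) (hook μ i j))
                   , skew-connected
                   , skew-no2x2

core⇒no-K-hook : ∀ {k μ} → IsCore k μ → ∀ {i j} → j < part μ i → hook μ i j ≢ suc k
core⇒no-K-hook {μ = μ} (μ-partition , no-rim-hook) j<μi hook≡K =
  no-rim-hook (ν , subst (λ r → RemovableRimHook r μ ν) hook≡K removableRimHook)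
  where open RimHook μ (proj₂ μ-partition) j<μi

multiplicity : ℕ → List ℕ → ℕ
multiplicity v = length ∘ filter (v ≟_)

multiplicity-++ : ∀ v xs ys → multiplicity v (xs ++ ys) ≡ multiplicity v xs + multiplicity v ys
multiplicity-++ v xs ys = trans (cong length (filter-++ (v ≟_) xs ys)) (length-++ (filter (v ≟_) xs))

multiplicity-↭ : ∀ v {xs ys} → xs ↭ ys → multiplicity v xs ≡ multiplicity v ys
multiplicity-↭ v = ↭-length ∘ filter-↭ (v ≟_)

multiplicity-∷-≡ : ∀ v xs → multiplicity v (v ∷ xs) ≡ suc (multiplicity v xs)
multiplicity-∷-≡ v xs = cong length (filter-accept (v ≟_) refl)

multiplicity-∷-≢ : ∀ {v x} xs → v ≢ x → multiplicity v (x ∷ xs) ≡ multiplicity v xs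
multiplicity-∷-≢ {v} xs v≢x = cong length (filter-reject (v ≟_) v≢x)

multiplicity-replicate : ∀ v n → multiplicity v (replicate n v) ≡ n
multiplicity-replicate v n = trans (cong length (filter-all (v ≟_) (replicate⁺ n refl))) (length-replicate n)

multiplicity-replicate-≢ : ∀ {v x} n → v ≢ x → multiplicity v (replicate n x) ≡ 0
multiplicity-replicate-≢ n v≢x = cong length (filter-none (_ ≟_) (replicate⁺ n v≢x))

multiplicity-rectangles : ∀ k v is → multiplicity v (concatMap (rect k) is) ≡ (suc k ∸ v) * multiplicity v is
multiplicity-rectangles k v []       = sym (*-zeroʳ (suc k ∸ v))
multiplicity-rectangles k v (x ∷ is) with v ≟ x
... | yes refl = begin
  multiplicity v (rect k v ++ concatMap (rect k) is)                 ≡⟨ multiplicity-++ v (rect k v) _ ⟩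
  multiplicity v (rect k v) + multiplicity v (concatMap (rect k) is) ≡⟨ cong₂ _+_ (multiplicity-replicate v (suc k ∸ v)) (multiplicity-rectangles k v is) ⟩
  (suc k ∸ v) + (suc k ∸ v) * multiplicity v is                      ≡⟨ *-suc (suc k ∸ v) _ ⟨
  (suc k ∸ v) * suc (multiplicity v is)                              ≡⟨ cong ((suc k ∸ v) *_) (multiplicity-∷-≡ v is) ⟨
  (suc k ∸ v) * multiplicity v (v ∷ is)                              ∎
  where open ≡-Reasoning
... | no v≢x = begin
  multiplicity v (rect k x ++ concatMap (rect k) is)                 ≡⟨ multiplicity-++ v (rect k x) _ ⟩
  multiplicity v (rect k x) + multiplicity v (concatMap (rect k) is) ≡⟨ cong₂ _+_ (multiplicity-replicate-≢ (suc k ∸ x) v≢x) (multiplicity-rectangles k v is) ⟩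
  (suc k ∸ v) * multiplicity v is                                    ≡⟨ cong ((suc k ∸ v) *_) (multiplicity-∷-≢ is v≢x) ⟨
  (suc k ∸ v) * multiplicity v (x ∷ is)                              ∎
  where open ≡-Reasoning

insertDesc≡insert : ∀ x l → insertDesc x l ≡ Sort.insert x l
insertDesc≡insert x []       = refl
insertDesc≡insert x (y ∷ ys) with y ≤? x
... | yes y≤x rewrite dec-true (y ≤? x) y≤x = refl
... | no  y≰x rewrite dec-false (y ≤? x) y≰x = cong (y ∷_) (insertDesc≡insert x ys)

sortDesc≡sort : ∀ l → sortDesc l ≡ Sort.sort l
sortDesc≡sort []       = refl
sortDesc≡sort (x ∷ xs) = trans (insertDesc≡insert x (sortDesc xs)) (cong (Sort.insert x) (sortDesc≡sort xs))

IsRunStart : (ℕ → ℕ) → ℕ → Set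
IsRunStart g zero    = ⊤
IsRunStart g (suc i) = g i ≢ g (suc i)

runStart⇒<earlier : ∀ g → NonIncreasing g → ∀ {i} → IsRunStart g i → ∀ {r} → r < i → g i < g r
runStart⇒<earlier g g↓ {suc i} gi≢g[1+i] r<1+i =
  <-≤-trans (≤∧≢⇒< (g↓ i) (gi≢g[1+i] ∘ sym)) (antitone g g↓ (s≤s⁻¹ r<1+i))

linked⇒nonIncreasing : ∀ {l} → Linked _≥_ l → NonIncreasing (part l)
linked⇒nonIncreasing []       _       = z≤n
linked⇒nonIncreasing [-]      _       = z≤n
linked⇒nonIncreasing (x≥y ∷ _) zero    = x≥y
linked⇒nonIncreasing (_ ∷ ys) (suc i) = linked⇒nonIncreasing ys i

multiplicity-absent : ∀ {v} xs → All (_< v) xs → multiplicity v xs ≡ 0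
multiplicity-absent {v} xs xs<v = cong length (filter-none (v ≟_) (All.map (λ x<v v≡x → <-irrefl (sym v≡x) x<v) xs<v))

linked-below : ∀ {x y ys} → Linked _≥_ (y ∷ ys) → y < x → All (_< x) ys
linked-below links y<x = All.map (λ y≥z → ≤-<-trans y≥z y<x) (All.tail (Linked⇒All (λ x≥y y≥z → ≤-trans y≥z x≥y) ≤-refl links))

RunFrom : (ℕ → ℕ) → ℕ → ℕ → Set
RunFrom g i n = (∀ {t} → t < n → g (i + t) ≡ g i) × g (i + n) ≢ g i

run-at-head : ∀ {x xs} → Linked _≥_ (x ∷ xs) → 0 < x → RunFrom (part (x ∷ xs)) 0 (multiplicity x (x ∷ xs))
run-at-head {x} {xs} links 0<x rewrite multiplicity-∷-≡ x xs = go xs links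
  where
    go : ∀ xs → Linked _≥_ (x ∷ xs) → (∀ {t} → t < suc (multiplicity x xs) → part (x ∷ xs) t ≡ x)
                                      × part xs (multiplicity x xs) ≢ x
    go [] _ = (λ { {zero} _ → refl ; {suc _} (s≤s ()) }) , λ 0≡x → <-irrefl 0≡x 0<x
    go (y ∷ ys) links with x ≟ y
    ... | yes refl rewrite multiplicity-∷-≡ x ys =
      let (run , end) = go ys (Linked.tail links) in
      (λ { {zero} _ → refl ; {suc t} t<m → run (s≤s⁻¹ t<m) }) , end
    ... | no x≢y rewrite multiplicity-∷-≢ ys x≢y
                       | multiplicity-absent ys (linked-below (Linked.tail links) (≤∧≢⇒< (Linked.head links) (x≢y ∘ sym))) =
      (λ { {zero} _ → refl ; {suc _} (s≤s ()) }) , x≢y ∘ sym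

run-at : ∀ {l} → Linked _≥_ l → All (0 <_) l → ∀ {i} → i < length l
       → (∀ {r} → r < i → part l i < part l r) → RunFrom (part l) i (multiplicity (part l i) l)
run-at {x ∷ xs} links (0<x ∷ _) {zero}  _ _ = run-at-head links 0<x
run-at {x ∷ xs} links (_ ∷ pos) {suc i} (s≤s i<len) earlier
  rewrite multiplicity-∷-≢ xs (<⇒≢ (earlier z<s)) = run-at (Linked.tail links) pos i<len (earlier ∘ s<s)

RectangularRuns : ℕ → (ℕ → ℕ) → ℕ → Set
RectangularRuns k ℓ Z = ∀ {i} → i < Z → IsRunStart ℓ i → Σ ℕ λ α → RunFrom ℓ i ((suc k ∸ ℓ i) * α)

RowAddable : (ℕ → ℕ) → ℕ → Set
RowAddable m zero    = ⊤
RowAddable m (suc i) = m (suc i) < m i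

-- m and ℓ stand for the rows of μ and of 𝔭(μ); N bounds the length of μ, Z is the length of 𝔭(μ).
module RowDivisibility
  (k : ℕ) (m ℓ : ℕ → ℕ) (N Z : ℕ)
  (shift : ∀ i → m (i + (suc k ∸ ℓ i)) + ℓ i ≡ m i)
  (ℓ≤k : ∀ i → ℓ i ≤ k)
  (m-vanishes-N : ∀ {i} → N ≤ i → m i ≡ 0)
  (ℓ-vanishes-Z : ∀ {i} → Z ≤ i → ℓ i ≡ 0)
  (ℓ-positive : ∀ {i} → i < Z → 0 < ℓ i)
  (runs : RectangularRuns k ℓ Z)
  where

  K : ℕ
  K = suc k

  gap : ℕ → ℕ
  gap i = K ∸ ℓ i

  gap+ℓ : ∀ i → gap i + ℓ i ≡ K
  gap+ℓ i = m∸n+n≡m (m≤n⇒m≤1+n (ℓ≤k i))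

  0<gap : ∀ i → 0 < gap i
  0<gap i = m<n⇒0<n∸m (s≤s (ℓ≤k i))

  shift-with : ∀ {r v} → ℓ r ≡ v → m (r + (K ∸ v)) + v ≡ m r
  shift-with {r} ℓr≡v = subst (λ v → m (r + (K ∸ v)) + v ≡ m r) ℓr≡v (shift r)

  m-periodic : ∀ {i} → Z ≤ i → ∀ n → m (i + n * K) ≡ m i
  m-periodic {i} Z≤i zero    = cong m (+-identityʳ i)
  m-periodic {i} Z≤i (suc n) = begin
    m (i + (K + n * K))     ≡⟨ cong m (regroup i K (n * K)) ⟩
    m (i + n * K + K)       ≡⟨ +-identityʳ _ ⟨
    m (i + n * K + K) + 0   ≡⟨ shift-with (ℓ-vanishes-Z (≤-trans Z≤i (m≤m+n i (n * K)))) ⟩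
    m (i + n * K)           ≡⟨ m-periodic Z≤i n ⟩
    m i                     ∎
    where
      open ≡-Reasoning
      regroup : ∀ i a b → i + (a + b) ≡ i + b + a
      regroup = solve-∀

  m-vanishes : ∀ {i} → Z ≤ i → m i ≡ 0
  m-vanishes {i} Z≤i = trans (sym (m-periodic Z≤i N)) (m-vanishes-N (≤-trans (m≤m*n N K) (m≤n+m (N * K) i)))

  RunStartOrAddable : ℕ → Set
  RunStartOrAddable i = IsRunStart ℓ i ⊎ RowAddable m i

  Divisible : ℕ → Set
  Divisible d = ∀ {i} → i + d ≡ Z → RunStartOrAddable i → K ∣ m i + d

  descend : ∀ {d} → (∀ {d'} → d' < d → Divisible d') → ∀ {i s x} → i + d ≡ Z → 0 < s → i + s ≤ Z
          → RunStartOrAddable (i + s) → m i + s ≡ m (i + s) + x * K → K ∣ m i + d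
  descend {d} rec {i} {s} {x} i+d≡Z 0<s i+s≤Z good drop =
    subst (K ∣_) (sym regroup) (∣m∣n⇒∣m+n (rec d∸s<d i+s+[d∸s]≡Z good) (n∣m*n x))
    where
      s≤d : s ≤ d
      s≤d = +-cancelˡ-≤ i s d (≤-trans i+s≤Z (≤-reflexive (sym i+d≡Z)))
      d∸s<d : d ∸ s < d
      d∸s<d = ∸-monoʳ-< 0<s s≤d
      i+s+[d∸s]≡Z : i + s + (d ∸ s) ≡ Z
      i+s+[d∸s]≡Z = trans (+-assoc i s (d ∸ s)) (trans (cong (i +_) (m+[n∸m]≡n s≤d)) i+d≡Z)
      regroup : m i + d ≡ m (i + s) + (d ∸ s) + x * K
      regroup = begin
        m i + d                         ≡⟨ cong (m i +_) (m+[n∸m]≡n s≤d) ⟨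
        m i + (s + (d ∸ s))             ≡⟨ +-assoc (m i) s (d ∸ s) ⟨
        m i + s + (d ∸ s)               ≡⟨ cong (_+ (d ∸ s)) drop ⟩
        m (i + s) + x * K + (d ∸ s)     ≡⟨ +-comm-middle (m (i + s)) (x * K) (d ∸ s) ⟩
        m (i + s) + (d ∸ s) + x * K     ∎
        where
          open ≡-Reasoning
          +-comm-middle : ∀ a b c → a + b + c ≡ a + c + b
          +-comm-middle = solve-∀

  run-drop : ∀ i n → (∀ {t} → t < gap i * n → ℓ (i + t) ≡ ℓ i) → m i + gap i * n ≡ m (i + gap i * n) + n * K
  run-drop i n in-run = begin
    m i + e * n                       ≡⟨ cong (_+ e * n) (chain n ≤-refl) ⟨
    m (i + e * n) + v * n + e * n     ≡⟨ regroup (m (i + e * n)) v e n ⟩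
    m (i + e * n) + n * (e + v)       ≡⟨ cong (λ x → m (i + e * n) + n * x) (gap+ℓ i) ⟩
    m (i + e * n) + n * K             ∎
    where
      open ≡-Reasoning
      v e : ℕ
      v = ℓ i
      e = gap i
      regroup : ∀ a v e n → a + v * n + e * n ≡ a + n * (e + v)
      regroup = solve-∀
      chain : ∀ j → j ≤ n → m (i + e * j) + v * j ≡ m i
      chain zero    _     = begin
        m (i + e * 0) + v * 0   ≡⟨ cong₂ _+_ (cong (λ t → m (i + t)) (*-zeroʳ e)) (*-zeroʳ v) ⟩
        m (i + 0) + 0           ≡⟨ +-identityʳ (m (i + 0)) ⟩
        m (i + 0)               ≡⟨ cong m (+-identityʳ i) ⟩
        m i                     ∎
      chain (suc j) 1+j≤n = begin
        m (i + e * suc j) + v * suc j         ≡⟨ cong₂ _+_ (cong m (regroup-row i e j)) (*-suc v j) ⟩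
        m (i + e * j + e) + (v + v * j)       ≡⟨ +-assoc (m (i + e * j + e)) v (v * j) ⟨
        m (i + e * j + e) + v + v * j         ≡⟨ cong (_+ v * j) (shift-with (in-run (*-monoʳ-< e 1+j≤n))) ⟩
        m (i + e * j) + v * j                 ≡⟨ chain j (<⇒≤ 1+j≤n) ⟩
        m i                                   ∎
        where
          instance _ = >-nonZero (0<gap i)
          regroup-row : ∀ i e j → i + e * suc j ≡ i + e * j + e
          regroup-row = solve-∀

  run-step : ∀ {d} → (∀ {d'} → d' < d → Divisible d') → ∀ {i} → i + d ≡ Z → i < Z → IsRunStart ℓ i → K ∣ m i + d
  run-step rec {i} i+d≡Z i<Z start =
    descend rec {x = α} i+d≡Z 0<eα i+eα≤Z (inj₁ next-start) (run-drop i α in-run)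
    where
      v e α : ℕ
      v = ℓ i
      e = gap i
      α = proj₁ (runs i<Z start)
      in-run : ∀ {t} → t < e * α → ℓ (i + t) ≡ v
      in-run = proj₁ (proj₂ (runs i<Z start))
      after-run : ℓ (i + e * α) ≢ v
      after-run = proj₂ (proj₂ (runs i<Z start))

      0<eα : 0 < e * α
      0<eα = n≢0⇒n>0 λ eα≡0 → after-run (trans (cong (λ t → ℓ (i + t)) eα≡0) (cong ℓ (+-identityʳ i)))
      last : ℕ
      last = i + pred (e * α)
      i+eα≡1+last : i + e * α ≡ suc last
      i+eα≡1+last = trans (cong (i +_) (sym (suc-pred (e * α)))) (+-suc i (pred (e * α)))
        where instance _ = >-nonZero 0<eα
      ℓ-last : ℓ last ≡ v
      ℓ-last = in-run (≤-reflexive (suc-pred (e * α)))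
        where instance _ = >-nonZero 0<eα
      i+eα≤Z : i + e * α ≤ Z
      i+eα≤Z = subst (_≤ Z) (sym i+eα≡1+last) (≰⇒> λ Z≤last →
        <-irrefl (trans (sym (ℓ-vanishes-Z Z≤last)) ℓ-last) (ℓ-positive i<Z))
      next-start : IsRunStart ℓ (i + e * α)
      next-start = subst (IsRunStart ℓ) (sym i+eα≡1+last)
                         (λ ℓlast≡ → after-run (trans (cong ℓ i+eα≡1+last) (trans (sym ℓlast≡) ℓ-last)))

  addable-step : ∀ {d} → (∀ {d'} → d' < d → Divisible d') → ∀ {i₀} → suc i₀ + d ≡ Z
               → ℓ i₀ ≡ ℓ (suc i₀) → RowAddable m (suc i₀) → K ∣ m (suc i₀) + d
  addable-step rec {i₀} i+d≡Z ℓ-same addable =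
    descend rec {x = 1} i+d≡Z (0<gap i) i+e≤Z (inj₂ next-addable) drop
    where
      i v e : ℕ
      i = suc i₀
      v = ℓ i
      e = gap i
      next-addable : RowAddable m (i + e)
      next-addable = +-cancelʳ-< v (m (i + e)) (m (i₀ + e))
                       (subst₂ _<_ (sym (shift i)) (sym (shift-with ℓ-same)) addable)
      i+e≤Z : i + e ≤ Z
      i+e≤Z = ≮⇒≥ λ Z<i+e → contradiction (subst (m (i + e) <_) (m-vanishes (s≤s⁻¹ Z<i+e)) next-addable) n≮0
      drop : m i + e ≡ m (i + e) + 1 * K
      drop = begin
        m i + e                  ≡⟨ cong (_+ e) (shift i) ⟨
        m (i + e) + v + e        ≡⟨ +-assoc (m (i + e)) v e ⟩
        m (i + e) + (v + e)      ≡⟨ cong (m (i + e) +_) (trans (+-comm v e) (gap+ℓ i)) ⟩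
        m (i + e) + K            ≡⟨ cong (m (i + e) +_) (+-identityʳ K) ⟨
        m (i + e) + 1 * K        ∎
        where open ≡-Reasoning

  divisible : ∀ d → Divisible d
  divisible = <-rec Divisible divisible-step
    where
      divisible-step : ∀ d → (∀ {d'} → d' < d → Divisible d') → Divisible d
      divisible-step zero    _   {i} i+0≡Z _ = subst (K ∣_) (sym (trans (+-identityʳ (m i)) (m-vanishes Z≤i))) (K ∣0)
        where Z≤i = ≤-reflexive (trans (sym i+0≡Z) (+-identityʳ i))
      divisible-step (suc d) rec {zero}   i+d≡Z _ = run-step rec i+d≡Z (subst (0 <_) i+d≡Z z<s) tt
      divisible-step (suc d) rec {suc i₀} i+d≡Z good with ℓ i₀ ≟ ℓ (suc i₀) | good
      ... | no ℓ-differs | _          = run-step rec i+d≡Z i<Z ℓ-differs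
        where i<Z = subst (suc i₀ <_) i+d≡Z (m<m+n (suc i₀) z<s)
      ... | yes ℓ-same  | inj₁ ℓ-differs = contradiction ℓ-same ℓ-differs
      ... | yes ℓ-same  | inj₂ addable   = addable-step rec i+d≡Z ℓ-same addable

  addable⇒divisible : ∀ {i} → i ≤ Z → RowAddable m i → K ∣ m i + (Z ∸ i)
  addable⇒divisible i≤Z addable = divisible _ (m+[n∸m]≡n i≤Z) (inj₂ addable)

module Residues (k : ℕ) where

  open ℤ using (+_; -[1+_])

  K : ℕ
  K = suc k

  -[1+]%ℕ : ∀ n → -[1+ n ] %ℕ K ≡ (K ∸ suc n % K) % K
  -[1+]%ℕ n with suc n % K | m%n<n (suc n) K
  ... | zero  | _     = sym (n%n≡0 K)
  ... | suc r | 1+r<K = sym (m<n⇒m%n≡m (∸-monoʳ-< z<s (<⇒≤ 1+r<K)))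

  K∸x%K : ∀ {x} → x ≤ K → (K ∸ x) % K ≡ (K ∸ x % K) % K
  K∸x%K {x} x≤K with m≤n⇒m<n∨m≡n x≤K
  ... | inj₁ x<K = cong (λ r → (K ∸ r) % K) (sym (m<n⇒m%n≡m x<K))
  ... | inj₂ refl = begin
    (K ∸ K) % K            ≡⟨ cong (_% K) (n∸n≡0 K) ⟩
    0                      ≡⟨ n%n≡0 K ⟨
    (K ∸ 0) % K            ≡⟨ cong (λ r → (K ∸ r) % K) (n%n≡0 K) ⟨
    (K ∸ K % K) % K        ∎
    where open ≡-Reasoning

  %ℕ-+K : ∀ x → (x ℤ.+ + K) %ℕ K ≡ x %ℕ K
  %ℕ-+K (+ n)    = [m+n]%n≡m%n n K
  %ℕ-+K -[1+ n ] with suc n ≤? K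
  ... | yes 1+n≤K = begin
    (K ℤ.⊖ suc n) %ℕ K        ≡⟨ cong (_%ℕ K) (ℤP.⊖-≥ 1+n≤K) ⟩
    (K ∸ suc n) % K           ≡⟨ K∸x%K 1+n≤K ⟩
    (K ∸ suc n % K) % K       ≡⟨ -[1+]%ℕ n ⟨
    -[1+ n ] %ℕ K             ∎
    where open ≡-Reasoning
  ... | no 1+n≰K = begin
    (K ℤ.⊖ suc n) %ℕ K              ≡⟨ cong (_%ℕ K) (ℤP.⊖-< (≰⇒> 1+n≰K)) ⟩
    (ℤ.- + (suc n ∸ K)) %ℕ K        ≡⟨ cong (λ r → (ℤ.- + r) %ℕ K) (+-∸-assoc 1 K≤n) ⟩
    -[1+ (n ∸ K) ] %ℕ K             ≡⟨ -[1+]%ℕ (n ∸ K) ⟩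
    (K ∸ suc (n ∸ K) % K) % K       ≡⟨ cong (λ r → (K ∸ r) % K) (sym ([m+n]%n≡m%n (suc (n ∸ K)) K)) ⟩
    (K ∸ (suc (n ∸ K) + K) % K) % K ≡⟨ cong (λ r → (K ∸ suc r % K) % K) (m∸n+n≡m K≤n) ⟩
    (K ∸ suc n % K) % K             ≡⟨ -[1+]%ℕ n ⟨
    -[1+ n ] %ℕ K                   ∎
    where
      open ≡-Reasoning
      K≤n : K ≤ n
      K≤n = s≤s⁻¹ (≰⇒> 1+n≰K)

  %ℕ-+multiple : ∀ x q → (x ℤ.+ + (q * K)) %ℕ K ≡ x %ℕ K
  %ℕ-+multiple x zero    = cong (_%ℕ K) (ℤP.+-identityʳ x)
  %ℕ-+multiple x (suc q) = begin
    (x ℤ.+ + (K + q * K)) %ℕ K       ≡⟨ cong (λ y → (x ℤ.+ y) %ℕ K) (ℤP.pos-+ K (q * K)) ⟩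
    (x ℤ.+ (+ K ℤ.+ + (q * K))) %ℕ K ≡⟨ cong (_%ℕ K) (ℤP.+-assoc x (+ K) (+ (q * K))) ⟨
    ((x ℤ.+ + K) ℤ.+ + (q * K)) %ℕ K ≡⟨ %ℕ-+multiple (x ℤ.+ + K) q ⟩
    (x ℤ.+ + K) %ℕ K                 ≡⟨ %ℕ-+K x ⟩
    x %ℕ K                           ∎
    where open ≡-Reasoning

  residue-congruent : ∀ {i a Z} → i ≤ Z → K ∣ a + (Z ∸ i) → residue k (i , a) ≡ residue k (Z , 0)
  residue-congruent {i} {a} {Z} i≤Z (divides q a+[Z∸i]≡qK) = begin
    (+ a ℤ.- + i) %ℕ K                            ≡⟨ cong (_%ℕ K) (regroup (+ a) (+ Z) (+ i)) ⟩
    ((+ 0 ℤ.- + Z) ℤ.+ (+ a ℤ.+ (+ Z ℤ.- + i))) %ℕ K ≡⟨ cong (λ y → ((+ 0 ℤ.- + Z) ℤ.+ y) %ℕ K) qK≡ ⟨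
    ((+ 0 ℤ.- + Z) ℤ.+ + (q * K)) %ℕ K            ≡⟨ %ℕ-+multiple (+ 0 ℤ.- + Z) q ⟩
    (+ 0 ℤ.- + Z) %ℕ K                            ∎
    where
      open ≡-Reasoning
      regroup : ∀ a z i → a ℤ.- i ≡ (ℤ.0ℤ ℤ.- z) ℤ.+ (a ℤ.+ (z ℤ.- i))
      regroup = ℤ-Solver.solve-∀
      qK≡ : + (q * K) ≡ + a ℤ.+ (+ Z ℤ.- + i)
      qK≡ = begin
        + (q * K)            ≡⟨ cong +_ a+[Z∸i]≡qK ⟨
        + (a + (Z ∸ i))      ≡⟨ ℤP.pos-+ a (Z ∸ i) ⟩
        + a ℤ.+ + (Z ∸ i)    ≡⟨ cong (λ y → + a ℤ.+ y) (trans (sym (ℤP.⊖-≥ i≤Z)) (sym (ℤP.m-n≡m⊖n Z i))) ⟩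
        + a ℤ.+ (+ Z ℤ.- + i) ∎

All⇒part : ∀ {P : ℕ → Set} {l} → All P l → ∀ {i} → i < length l → P (part l i)
All⇒part (px ∷ _)  {zero}  _          = px
All⇒part (_ ∷ pxs) {suc i} (s≤s i<len) = All⇒part pxs i<len

module RectangleUnion (k : ℕ) (is : List ℕ) (is-positive : All (0 <_) is) where

  R : List ℕ
  R = rectUnion k is

  rectangles : List ℕ
  rectangles = concatMap (rect k) is

  R↭rectangles : R ↭ rectangles
  R↭rectangles = subst (_↭ rectangles) (sym (sortDesc≡sort rectangles)) (sort-↭ rectangles)

  R-sorted : Linked _≥_ R
  R-sorted = subst (Linked _≥_) (sym (sortDesc≡sort rectangles)) (sort-↗ rectangles)

  R↓ : NonIncreasing (part R)
  R↓ = linked⇒nonIncreasing R-sorted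

  R-positive : All (0 <_) R
  R-positive = All-resp-↭ (↭-sym R↭rectangles)
                 (concat⁺ (map⁺ (All.map (λ {x} 0<x → replicate⁺ (suc k ∸ x) 0<x) is-positive)))

  part-R-positive : ∀ {i} → i < length R → 0 < part R i
  part-R-positive = All⇒part R-positive

  R-runs : RectangularRuns k (part R) (length R)
  R-runs {i} i<Z start =
    multiplicity v is , subst (RunFrom (part R) i) #v≡ (run-at R-sorted R-positive i<Z (runStart⇒<earlier (part R) R↓ start))
    where
      v = part R i
      #v≡ : multiplicity v R ≡ (suc k ∸ v) * multiplicity v is
      #v≡ = trans (multiplicity-↭ v R↭rectangles) (multiplicity-rectangles k v is)

addable⇒rowAddable : ∀ {μ i j} → Addable μ (i , j) → RowAddable (part μ) i
addable⇒rowAddable {i = zero}            _               = tt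
addable⇒rowAddable {μ} {suc i₀} (j≡ , inj₂ j<μi₀) = subst (_< part μ i₀) j≡ j<μi₀

unique-addable-residue : ∀ k is → All (0 <_) is → ∀ μ → IsCore k μ
  → (∀ i → pPart k μ i ≡ part (rectUnion k is) i)
  → Σ ℕ λ r → r ≤ k × HasAddableResidue k μ r × (∀ r' → r' ≤ k → HasAddableResidue k μ r' → r' ≡ r)
unique-addable-residue k is is-positive μ core p≡R =
  residue k (Z , 0) , s≤s⁻¹ (n%ℕd<d (ℤ.+ 0 ℤ.- ℤ.+ Z) (suc k)) , ((Z , 0) , Z-addable , refl) , unique
  where
    open RectangleUnion k is is-positive
    open CoreRows k μ (proj₂ (proj₁ core)) (core⇒no-K-hook core) using (pPart≤part; pPart≤k; part-shift)
    open Residues k using (residue-congruent)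

    Z : ℕ
    Z = length R

    shift : ∀ i → part μ (i + (suc k ∸ part R i)) + part R i ≡ part μ i
    shift i = subst (λ v → part μ (i + (suc k ∸ v)) + v ≡ part μ i) (p≡R i) (part-shift i)

    open RowDivisibility k (part μ) (part R) (length μ) Z shift (λ i → subst (_≤ k) (p≡R i) (pPart≤k i))
                         (part-≥length μ) (part-≥length R) part-R-positive R-runs
      using (m-vanishes; addable⇒divisible)

    Z-addable : Addable μ (Z , 0)
    Z-addable = sym (m-vanishes ≤-refl) , above Z ≤-refl
      where
        above : ∀ z → z ≤ Z → z ≡ 0 ⊎ 0 < part μ (z ∸ 1)
        above zero     _    = inj₁ refl
        above (suc z) z<Z = inj₂ (≤-trans (part-R-positive z<Z) (subst (_≤ part μ z) (p≡R z) (pPart≤part z)))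

    addable-row≤Z : ∀ {i j} → Addable μ (i , j) → i ≤ Z
    addable-row≤Z {zero}   _                  = z≤n
    addable-row≤Z {suc i₀} (_ , inj₂ j<μi₀) = ≮⇒≥ λ Z<1+i₀ →
      contradiction (subst (_ <_) (m-vanishes (s≤s⁻¹ Z<1+i₀)) j<μi₀) n≮0

    unique : ∀ r' → r' ≤ k → HasAddableResidue k μ r' → r' ≡ residue k (Z , 0)
    unique r' _ ((i , j) , addable@(j≡ , _) , res≡r') = begin
      r'                        ≡⟨ res≡r' ⟨
      residue k (i , j)         ≡⟨ cong (λ j → residue k (i , j)) j≡ ⟩
      residue k (i , part μ i)  ≡⟨ residue-congruent i≤Z (addable⇒divisible i≤Z (addable⇒rowAddable {μ} addable)) ⟩
      residue k (Z , 0)         ∎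
      where
        open ≡-Reasoning
        i≤Z = addable-row≤Z addable

mainTheorem6 : (k m : ℕ) → 1 ≤ k → 1 < m → (is : Vec ℕ (m ∸ 1))
    → (∀ t → 1 ≤ lookup is t × lookup is t ≤ k)
    → (μ : List ℕ) → IsCore k μ
    → (∀ i → pPart k μ i ≡ part (rectUnion k (toList is)) i)
    → Σ ℕ λ r → r ≤ k × HasAddableResidue k μ r
        × (∀ r' → r' ≤ k → HasAddableResidue k μ r' → r' ≡ r)
mainTheorem6 k _ _ _ is bounds =
  unique-addable-residue k (toList is) (toList⁺ (lookup⁻ (proj₁ ∘ bounds)))
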